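{- For every integer $k\ge1$, with $n=8k+2$, we have $\mathsf{gran}(\mathrm{THR}_n^3)=n-3$.
   Context: $\mathrm{THR}_n^3\colon\{0,1\}^n\to\{ -1,1\}$ is defined by $\mathrm{THR}_n^3(x)=-1$ iff $\sum_{i=1}^n x_i\ge 3$. For $S\subseteq[n]$, $\widehat{f}(S)=2^{ -n}\sum_{x}f(x)\prod_{i\in S}(-1)^{x_i}$. For a rational $\alpha$ whose denominator is a power of $2$, $\mathsf{gran}(\alpha)$ is the minimal integer $k\ge0$ with $2^k\alpha\in\mathbb{Z}$; $\mathsf{gran}(f)=\max_{S\subseteq[n]}\mathsf{gran}(\widehat{f}(S))$. -}

module Defs where

open import Data.Bool using (Bool; true; false; if_then_else_)
open import Data.Nat as ℕ using (ℕ; zero; suc; _≥_; _<_; _≤_)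
open import Data.Nat.Properties using (m^n≢0)
open import Data.Integer as ℤ using (ℤ; +_; -_)
open import Data.Rational as ℚ using (ℚ; _/_)
open import Data.Vec using (Vec; []; _∷_; count)
open import Data.List using (List; []; _∷_; map; _++_; foldr)
open import Data.Product using (Σ; ∃; _×_)
open import Relation.Binary.PropositionalEquality using (_≡_)
open import Relation.Nullary using (¬_)
open import Relation.Nullary.Decidable using (does)
open import Data.Bool.Properties using (T?)

-- Boolean cube {0,1}^n: a point x is a Vec Bool n (true = 1, false = 0).
-- All points of {0,1}^n, listed explicitly.
cube : (n : ℕ) → List (Vec Bool n)
cube zero    = [] ∷ []
cube (suc n) = map (false ∷_) (cube n) ++ map (true ∷_) (cube n)

-- Subsets S ⊆ [n] are characteristic vectors Vec Bool n (true = i ∈ S);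
-- so subsets of [n] are also enumerated by `cube n`.

weight : {n : ℕ} → Vec Bool n → ℕ
weight x = count T? x

THR3 : (n : ℕ) → Vec Bool n → ℤ
THR3 n x with 3 ℕ.≤? weight x
... | Relation.Nullary.yes _ = - (+ 1)
... | Relation.Nullary.no  _ = + 1

chi : {n : ℕ} → Vec Bool n → Vec Bool n → ℤ
chi []          []          = + 1
chi (false ∷ S) (_ ∷ x)     = chi S x
chi (true ∷ S)  (false ∷ x) = chi S x
chi (true ∷ S)  (true ∷ x)  = - chi S x

sumℤ : List ℤ → ℤ
sumℤ = foldr ℤ._+_ (+ 0)

fourier : (n : ℕ) → (Vec Bool n → ℤ) → Vec Bool n → ℚ
fourier n f S =
  _/_ (sumℤ (map (λ x → f x ℤ.* chi S x) (cube n))) (2 ℕ.^ n) {{m^n≢0 2 n}}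

IsInt : ℚ → Set
IsInt q = ∃ λ (z : ℤ) → q ≡ (z / 1)

IsGran : ℚ → ℕ → Set
IsGran α k =
  IsInt ((+ (2 ℕ.^ k) / 1) ℚ.* α) ×
  (∀ j → j < k → ¬ IsInt ((+ (2 ℕ.^ j) / 1) ℚ.* α))

IsGranFun : (n : ℕ) → (Vec Bool n → ℤ) → ℕ → Set
IsGranFun n f k =
  (∃ λ (S : Vec Bool n) → IsGran (fourier n f S) k) ×
  (∀ (S : Vec Bool n) (j : ℕ) → IsGran (fourier n f S) j → j ≤ k)

-- THR³ₙ = 2·[|x| ≤ 2] − 1 is symmetric, so the numerator 2ⁿ f̂(S) depends only on s = |S|:
-- it is 2 (K₀ + K₁ + K₂)(s) − 2ⁿ[s = 0] = (n + 1 − 2s)² + 1 − n − 2ⁿ[s = 0],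
-- obtained by induction on S from a Pascal-type recursion for the coefficients of x ↦ g (t + |x|).
-- For n = 8k + 2 the number n + 1 − 2s is odd and odd squares are 1 mod 8, so every numerator is
-- divisible by 8, while s = 4k or 4k + 1 (according to the parity of k) makes it 8 times an odd
-- number. So every 2ⁿ⁻³ f̂(S) is an integer but some 2ⁿ⁻⁴ f̂(S) is not.
module Submission where

open import Data.Bool using (Bool; true; false)
open import Data.Nat as ℕ using (ℕ; zero; suc; NonZero; _^_; _≤_; _<_; _∸_; z≤n; s≤s)
import Data.Nat.Properties as ℕ
open import Data.Nat.Divisibility using (_∣_; *-monoʳ-∣; *-cancelˡ-∣; ∣-trans; ∣1⇒≡1; m∣m*n)
open import Data.Integer as ℤ using (ℤ; +_; -_)
import Data.Integer.Properties as ℤ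
import Data.Integer.Divisibility.Signed as Signed
open import Data.Integer.Tactic.RingSolver using (solve-∀)
open import Data.Rational as ℚ using (ℚ; _/_; toℚᵘ)
import Data.Rational.Properties as ℚ
open import Data.Rational.Unnormalised as ℚᵘ using (mkℚᵘ; *≡*; _≃_)
import Data.Rational.Unnormalised.Properties as ℚᵘ
open import Data.Vec using (Vec; []; _∷_)
open import Data.List using (map; _++_; []; _∷_)
import Data.List.Properties as List
open import Data.Product using (∃; _×_; _,_)
open import Data.Sum using (_⊎_; inj₁; inj₂)
open import Function.Base using (id; _∘_)
open import Function.Bundles using (_⇔_; mk⇔; Equivalence)
open import Relation.Binary.PropositionalEquality
open import Relation.Nullary using (¬_; yes; no; contradiction)

open import Defs

toℚᵘ-*-/ : ∀ p x c → toℚᵘ ((p / 1) ℚ.* (x / suc c)) ≃ mkℚᵘ p 0 ℚᵘ.* mkℚᵘ x c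
toℚᵘ-*-/ p x c = ℚᵘ.≃-trans (ℚ.toℚᵘ-homo-* (p / 1) (x / suc c))
  (ℚᵘ.*-cong (ℚ.toℚᵘ-fromℚᵘ (mkℚᵘ p 0)) (ℚ.toℚᵘ-fromℚᵘ (mkℚᵘ x c)))

isInt-*-/⇔∣ : ∀ p x d .{{_ : NonZero d}} → IsInt ((p / 1) ℚ.* (x / d)) ⇔ + d Signed.∣ p ℤ.* x
isInt-*-/⇔∣ p x (suc c) = mk⇔ to from
  where
  cross-multiplied : ∀ z → ((p ℤ.* x) ℤ.* + 1 ≡ z ℤ.* + (1 ℕ.* suc c)) ≡ (p ℤ.* x ≡ z ℤ.* + suc c)
  cross-multiplied z = cong₂ _≡_ (ℤ.*-identityʳ (p ℤ.* x)) (cong (λ m → z ℤ.* + m) (ℕ.*-identityˡ (suc c)))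

  to : IsInt ((p / 1) ℚ.* (x / suc c)) → + suc c Signed.∣ p ℤ.* x
  to (z , eq) with ℚᵘ.≃-trans (ℚᵘ.≃-sym (toℚᵘ-*-/ p x c))
                     (ℚᵘ.≃-trans (ℚ.toℚᵘ-cong eq) (ℚ.toℚᵘ-fromℚᵘ (mkℚᵘ z 0)))
  ... | *≡* eq′ = Signed.divides z (subst id (cross-multiplied z) eq′)

  from : + suc c Signed.∣ p ℤ.* x → IsInt ((p / 1) ℚ.* (x / suc c))
  from (Signed.divides z eq) = z , ℚ.toℚᵘ-injective (ℚᵘ.≃-trans (toℚᵘ-*-/ p x c)
    (ℚᵘ.≃-trans (*≡* (subst id (sym (cross-multiplied z)) eq)) (ℚᵘ.≃-sym (ℚ.toℚᵘ-fromℚᵘ (mkℚᵘ z 0)))))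

_/2^_ : ℤ → ℕ → ℚ
N /2^ n = _/_ N (2 ^ n) {{ℕ.m^n≢0 2 n}}

isInt-2^*-/2^⇔∣ : ∀ i n N → IsInt ((+ (2 ^ i) / 1) ℚ.* (N /2^ n)) ⇔ 2 ^ n ∣ 2 ^ i ℕ.* ℤ.∣ N ∣
isInt-2^*-/2^⇔∣ i n N = mk⇔
  (λ int → subst (2 ^ n ∣_) (ℤ.abs-* (+ (2 ^ i)) N) (Signed.∣⇒∣ᵤ (Equivalence.to equiv int)))
  (λ 2^n∣ → Equivalence.from equiv (Signed.∣ᵤ⇒∣ (subst (2 ^ n ∣_) (sym (ℤ.abs-* (+ (2 ^ i)) N)) 2^n∣)))
  where equiv = isInt-*-/⇔∣ (+ (2 ^ i)) N (2 ^ n) {{ℕ.m^n≢0 2 n}}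

2^-split : ∀ {m n} → m ≤ n → 2 ^ n ≡ 2 ^ m ℕ.* 2 ^ (n ∸ m)
2^-split {m} {n} m≤n = begin
  2 ^ n                   ≡⟨ cong (2 ^_) (ℕ.m+[n∸m]≡n m≤n) ⟨
  2 ^ (m ℕ.+ (n ∸ m))     ≡⟨ ℕ.^-distribˡ-+-* 2 m (n ∸ m) ⟩
  2 ^ m ℕ.* 2 ^ (n ∸ m)   ∎
  where open ≡-Reasoning

2^-mono-∣ : ∀ {m n} → m ≤ n → 2 ^ m ∣ 2 ^ n
2^-mono-∣ {m} {n} m≤n = subst (2 ^ m ∣_) (sym (2^-split m≤n)) (m∣m*n (2 ^ (n ∸ m)))

isGran-minimal : ∀ {α j i} → IsGran α j → IsInt ((+ (2 ^ i) / 1) ℚ.* α) → j ≤ i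
isGran-minimal (_ , below-not-int) int = ℕ.≮⇒≥ (λ i<j → below-not-int _ i<j int)

isInt-2^[n∸a]*-/2^ : ∀ {a n} N → a ≤ n → 2 ^ a ∣ ℤ.∣ N ∣ → IsInt ((+ (2 ^ (n ∸ a)) / 1) ℚ.* (N /2^ n))
isInt-2^[n∸a]*-/2^ {a} {n} N a≤n 2^a∣N = Equivalence.from (isInt-2^*-/2^⇔∣ (n ∸ a) n N)
  (subst (_∣ 2 ^ (n ∸ a) ℕ.* ℤ.∣ N ∣) (trans (ℕ.*-comm (2 ^ (n ∸ a)) (2 ^ a)) (sym (2^-split a≤n)))
    (*-monoʳ-∣ (2 ^ (n ∸ a)) 2^a∣N))

isGran-/2^ : ∀ {a n} N → a ≤ n → 2 ^ a ∣ ℤ.∣ N ∣ → ¬ 2 ^ suc a ∣ ℤ.∣ N ∣ → IsGran (N /2^ n) (n ∸ a)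
isGran-/2^ {a} {n} N a≤n 2^a∣N 2^[1+a]∤N = isInt-2^[n∸a]*-/2^ N a≤n 2^a∣N , not-int
  where
  not-int : ∀ j → j < n ∸ a → ¬ IsInt ((+ (2 ^ j) / 1) ℚ.* (N /2^ n))
  not-int j j<n∸a int = 2^[1+a]∤N (*-cancelˡ-∣ (2 ^ j) {{ℕ.m^n≢0 2 j}} (∣-trans 2^j*2^[1+a]∣2^n 2^n∣2^j*N))
    where
    j+[1+a]≤n : j ℕ.+ suc a ≤ n
    j+[1+a]≤n = subst (_≤ n) (sym (ℕ.+-suc j a)) (subst (suc j ℕ.+ a ≤_) (ℕ.m∸n+n≡m a≤n) (ℕ.+-monoˡ-≤ a j<n∸a))
    2^j*2^[1+a]∣2^n : 2 ^ j ℕ.* 2 ^ suc a ∣ 2 ^ n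
    2^j*2^[1+a]∣2^n = subst (_∣ 2 ^ n) (ℕ.^-distribˡ-+-* 2 j (suc a)) (2^-mono-∣ j+[1+a]≤n)
    2^n∣2^j*N : 2 ^ n ∣ 2 ^ j ℕ.* ℤ.∣ N ∣
    2^n∣2^j*N = Equivalence.to (isInt-2^*-/2^⇔∣ j n N) int

numerator : (n : ℕ) → (Vec Bool n → ℤ) → Vec Bool n → ℤ
numerator n f S = sumℤ (map (λ x → f x ℤ.* chi S x) (cube n))

isGranFun-dyadic : ∀ {n a} (f : Vec Bool n → ℤ) → a ≤ n →
  (∀ S → 2 ^ a ∣ ℤ.∣ numerator n f S ∣) → (∃ λ S → ¬ 2 ^ suc a ∣ ℤ.∣ numerator n f S ∣) →
  IsGranFun n f (n ∸ a)
isGranFun-dyadic f a≤n 2^a∣ (S₀ , 2^[1+a]∤) =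
  (S₀ , isGran-/2^ (numerator _ f S₀) a≤n (2^a∣ S₀) 2^[1+a]∤) ,
  λ S j gran → isGran-minimal gran (isInt-2^[n∸a]*-/2^ (numerator _ f S) a≤n (2^a∣ S))

¬2^[1+a]∣2^a*odd : ∀ a W → ¬ 2 ^ suc a ∣ ℤ.∣ + (2 ^ a) ℤ.* (+ 1 ℤ.+ + 2 ℤ.* W) ∣
¬2^[1+a]∣2^a*odd a W 2^[1+a]∣ = contradiction (∣1⇒≡1 (Signed.∣⇒∣ᵤ 2∣1)) λ ()
  where
  2∣odd : 2 ∣ ℤ.∣ + 1 ℤ.+ + 2 ℤ.* W ∣
  2∣odd = *-cancelˡ-∣ (2 ^ a) {{ℕ.m^n≢0 2 a}}
    (subst₂ _∣_ (ℕ.*-comm 2 (2 ^ a)) (ℤ.abs-* (+ (2 ^ a)) _) 2^[1+a]∣)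
  2∣1 : + 2 Signed.∣ + 1
  2∣1 = Signed.∣m+n∣n⇒∣m (Signed.∣ᵤ⇒∣ 2∣odd) (Signed.divides W (ℤ.*-comm (+ 2) W))

module Numerators where

  open import Data.Integer using (_+_; _-_; _*_)
  open ≡-Reasoning

  sumℤ-++ : ∀ xs ys → sumℤ (xs ++ ys) ≡ sumℤ xs + sumℤ ys
  sumℤ-++ []       ys = sym (ℤ.+-identityˡ (sumℤ ys))
  sumℤ-++ (x ∷ xs) ys = trans (cong (λ s → x + s) (sumℤ-++ xs ys)) (sym (ℤ.+-assoc x (sumℤ xs) (sumℤ ys)))

  sumℤ-map-neg : ∀ {A : Set} (F : A → ℤ) xs → sumℤ (map (-_ ∘ F) xs) ≡ - sumℤ (map F xs)
  sumℤ-map-neg F []       = refl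
  sumℤ-map-neg F (x ∷ xs) = trans (cong (λ s → - F x + s) (sumℤ-map-neg F xs)) (sym (ℤ.neg-distrib-+ (F x) _))

  sumℤ-cube-suc : ∀ {m} (F : Vec Bool (suc m) → ℤ) →
    sumℤ (map F (cube (suc m))) ≡ sumℤ (map (F ∘ (false ∷_)) (cube m)) + sumℤ (map (F ∘ (true ∷_)) (cube m))
  sumℤ-cube-suc {m} F = begin
    sumℤ (map F (map (false ∷_) (cube m) ++ map (true ∷_) (cube m)))
      ≡⟨ cong sumℤ (List.map-++ F (map (false ∷_) (cube m)) _) ⟩
    sumℤ (map F (map (false ∷_) (cube m)) ++ map F (map (true ∷_) (cube m)))
      ≡⟨ sumℤ-++ (map F (map (false ∷_) (cube m))) _ ⟩
    sumℤ (map F (map (false ∷_) (cube m))) + sumℤ (map F (map (true ∷_) (cube m)))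
      ≡⟨ cong₂ (λ xs ys → sumℤ xs + sumℤ ys) (List.map-∘ (cube m)) (List.map-∘ (cube m)) ⟨
    sumℤ (map (F ∘ (false ∷_)) (cube m)) + sumℤ (map (F ∘ (true ∷_)) (cube m)) ∎

  weightCoeff : ∀ {m} → (ℕ → ℤ) → ℕ → Vec Bool m → ℤ
  weightCoeff {m} g t = numerator m (λ x → g (t ℕ.+ weight x))

  weightCoeff-false : ∀ {m} g t (S : Vec Bool m) →
    weightCoeff g t (false ∷ S) ≡ weightCoeff g t S + weightCoeff g (suc t) S
  weightCoeff-false {m} g t S = begin
    weightCoeff g t (false ∷ S)
      ≡⟨ sumℤ-cube-suc (λ x → g (t ℕ.+ weight x) * chi (false ∷ S) x) ⟩
    weightCoeff g t S + sumℤ (map (λ x → g (t ℕ.+ suc (weight x)) * chi S x) (cube m))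
      ≡⟨ cong (λ c → weightCoeff g t S + sumℤ c) (List.map-cong shift (cube m)) ⟩
    weightCoeff g t S + weightCoeff g (suc t) S
      ∎
    where
    shift : ∀ x → g (t ℕ.+ suc (weight x)) * chi S x ≡ g (suc t ℕ.+ weight x) * chi S x
    shift x = cong (λ w → g w * chi S x) (ℕ.+-suc t (weight x))

  weightCoeff-true : ∀ {m} g t (S : Vec Bool m) →
    weightCoeff g t (true ∷ S) ≡ weightCoeff g t S - weightCoeff g (suc t) S
  weightCoeff-true {m} g t S = begin
    weightCoeff g t (true ∷ S)
      ≡⟨ sumℤ-cube-suc (λ x → g (t ℕ.+ weight x) * chi (true ∷ S) x) ⟩
    weightCoeff g t S + sumℤ (map (λ x → g (t ℕ.+ suc (weight x)) * - chi S x) (cube m))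
      ≡⟨ cong (λ c → weightCoeff g t S + sumℤ c) (List.map-cong shift (cube m)) ⟩
    weightCoeff g t S + sumℤ (map (-_ ∘ λ x → g (suc t ℕ.+ weight x) * chi S x) (cube m))
      ≡⟨ cong (λ c → weightCoeff g t S + c) (sumℤ-map-neg _ (cube m)) ⟩
    weightCoeff g t S - weightCoeff g (suc t) S
      ∎
    where
    shift : ∀ x → g (t ℕ.+ suc (weight x)) * - chi S x ≡ - (g (suc t ℕ.+ weight x) * chi S x)
    shift x = trans (cong (λ w → g w * - chi S x) (ℕ.+-suc t (weight x)))
                    (sym (ℤ.neg-distribʳ-* (g (suc t ℕ.+ weight x)) (chi S x)))

  thr : ℕ → ℤ
  thr w with 3 ℕ.≤? w
  ... | yes _ = - + 1
  ... | no  _ = + 1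

  THR3≡thr∘weight : ∀ n x → THR3 n x ≡ thr (weight x)
  THR3≡thr∘weight n x with 3 ℕ.≤? weight x
  ... | yes _ = refl
  ... | no  _ = refl

  thr-≥3 : ∀ {w} → 3 ≤ w → thr w ≡ - + 1
  thr-≥3 {w} 3≤w with 3 ℕ.≤? w
  ... | yes _   = refl
  ... | no  3≰w = contradiction 3≤w 3≰w

  -- Σₓ χ_S(x), that is, 2 ^ m if S = ∅ and 0 otherwise.
  δ∅ : ∀ {m} → Vec Bool m → ℤ
  δ∅ []          = + 1
  δ∅ (false ∷ S) = δ∅ S + δ∅ S
  δ∅ (true  ∷ S) = + 0

  -- 2 (K₀ + K₁ + K₂)(s) for the Krawtchouk polynomials Kᵢ of length m.
  krawtchoukSum : ℤ → ℤ → ℤ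
  krawtchoukSum m s = (m - + 2 * s + + 1) * (m - + 2 * s + + 1) + + 1 - m

  weightCoeff-thr-≥3 : ∀ {m t} → 3 ≤ t → (S : Vec Bool m) → weightCoeff thr t S ≡ - δ∅ S
  weightCoeff-thr-≥3 {t = t} 3≤t []          = cong (λ c → c * + 1 + + 0) (thr-≥3 (ℕ.≤-trans 3≤t (ℕ.m≤m+n t 0)))
  weightCoeff-thr-≥3 {t = t} 3≤t (false ∷ S) = begin
    weightCoeff thr t (false ∷ S)                ≡⟨ weightCoeff-false thr t S ⟩
    weightCoeff thr t S + weightCoeff thr (suc t) S
      ≡⟨ cong₂ _+_ (weightCoeff-thr-≥3 3≤t S) (weightCoeff-thr-≥3 (ℕ.m≤n⇒m≤1+n 3≤t) S) ⟩
    - δ∅ S + - δ∅ S                             ≡⟨ ℤ.neg-distrib-+ (δ∅ S) (δ∅ S) ⟨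
    - δ∅ (false ∷ S)                            ∎
  weightCoeff-thr-≥3 {t = t} 3≤t (true ∷ S)  = begin
    weightCoeff thr t (true ∷ S)                 ≡⟨ weightCoeff-true thr t S ⟩
    weightCoeff thr t S - weightCoeff thr (suc t) S
      ≡⟨ cong₂ _-_ (weightCoeff-thr-≥3 3≤t S) (weightCoeff-thr-≥3 (ℕ.m≤n⇒m≤1+n 3≤t) S) ⟩
    - δ∅ S - - δ∅ S                             ≡⟨ ℤ.+-inverseʳ (- δ∅ S) ⟩
    + 0                                         ∎

  weightCoeff-thr-2 : ∀ {m} (S : Vec Bool m) → weightCoeff thr 2 S ≡ + 2 - δ∅ S
  weightCoeff-thr-2 []          = refl
  weightCoeff-thr-2 (false ∷ S) = trans (weightCoeff-false thr 2 S)
    (trans (cong₂ _+_ (weightCoeff-thr-2 S) (weightCoeff-thr-≥3 ℕ.≤-refl S)) (identity (δ∅ S)))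
    where
    identity : ∀ E → (+ 2 - E) + - E ≡ + 2 - (E + E)
    identity = solve-∀
  weightCoeff-thr-2 (true ∷ S)  = trans (weightCoeff-true thr 2 S)
    (trans (cong₂ _-_ (weightCoeff-thr-2 S) (weightCoeff-thr-≥3 ℕ.≤-refl S)) (identity (δ∅ S)))
    where
    identity : ∀ E → (+ 2 - E) - - E ≡ + 2 - + 0
    identity = solve-∀

  weightCoeff-thr-1 : ∀ {m} (S : Vec Bool m) →
    weightCoeff thr 1 S ≡ + 2 + + 2 * (+ m - + 2 * + weight S) - δ∅ S
  weightCoeff-thr-1 []                  = refl
  weightCoeff-thr-1 {suc m} (false ∷ S) = trans (weightCoeff-false thr 1 S)
    (trans (cong₂ _+_ (weightCoeff-thr-1 S) (weightCoeff-thr-2 S)) (identity (+ m) (+ weight S) (δ∅ S)))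
    where
    identity : ∀ M W E → (+ 2 + + 2 * (M - + 2 * W) - E) + (+ 2 - E)
                       ≡ + 2 + + 2 * (+ 1 + M - + 2 * W) - (E + E)
    identity = solve-∀
  weightCoeff-thr-1 {suc m} (true ∷ S)  = trans (weightCoeff-true thr 1 S)
    (trans (cong₂ _-_ (weightCoeff-thr-1 S) (weightCoeff-thr-2 S)) (identity (+ m) (+ weight S) (δ∅ S)))
    where
    identity : ∀ M W E → (+ 2 + + 2 * (M - + 2 * W) - E) - (+ 2 - E)
                       ≡ + 2 + + 2 * (+ 1 + M - + 2 * (+ 1 + W)) - + 0
    identity = solve-∀

  weightCoeff-thr-0 : ∀ {m} (S : Vec Bool m) → weightCoeff thr 0 S ≡ krawtchoukSum (+ m) (+ weight S) - δ∅ S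
  weightCoeff-thr-0 []                  = refl
  weightCoeff-thr-0 {suc m} (false ∷ S) = trans (weightCoeff-false thr 0 S)
    (trans (cong₂ _+_ (weightCoeff-thr-0 S) (weightCoeff-thr-1 S)) (identity (+ m) (+ weight S) (δ∅ S)))
    where
    identity : ∀ M W E → let d = M - + 2 * W + + 1; d′ = + 1 + M - + 2 * W + + 1 in
      (d * d + + 1 - M - E) + (+ 2 + + 2 * (M - + 2 * W) - E) ≡ d′ * d′ + + 1 - (+ 1 + M) - (E + E)
    identity = solve-∀
  weightCoeff-thr-0 {suc m} (true ∷ S)  = trans (weightCoeff-true thr 0 S)
    (trans (cong₂ _-_ (weightCoeff-thr-0 S) (weightCoeff-thr-1 S)) (identity (+ m) (+ weight S) (δ∅ S)))
    where
    identity : ∀ M W E → let d = M - + 2 * W + + 1; d′ = + 1 + M - + 2 * (+ 1 + W) + + 1 in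
      (d * d + + 1 - M - E) - (+ 2 + + 2 * (M - + 2 * W) - E) ≡ d′ * d′ + + 1 - (+ 1 + M) - + 0
    identity = solve-∀

  numerator-THR3 : ∀ m (S : Vec Bool m) → numerator m (THR3 m) S ≡ krawtchoukSum (+ m) (+ weight S) - δ∅ S
  numerator-THR3 m S = trans (cong sumℤ (List.map-cong (λ x → cong (_* chi S x) (THR3≡thr∘weight m x)) (cube m)))
                             (weightCoeff-thr-0 S)

  δ∅-nonempty : ∀ {m} (S : Vec Bool m) → weight S ≢ 0 → δ∅ S ≡ + 0
  δ∅-nonempty []          w≢0 = contradiction refl w≢0
  δ∅-nonempty (false ∷ S) w≢0 = cong₂ _+_ (δ∅-nonempty S w≢0) (δ∅-nonempty S w≢0)
  δ∅-nonempty (true  ∷ S) _   = refl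

  δ∅≡0⊎2^m : ∀ {m} (S : Vec Bool m) → δ∅ S ≡ + 0 ⊎ δ∅ S ≡ + (2 ℕ.^ m)
  δ∅≡0⊎2^m []          = inj₂ refl
  δ∅≡0⊎2^m (true  ∷ S) = inj₁ refl
  δ∅≡0⊎2^m {suc m} (false ∷ S) with δ∅≡0⊎2^m S
  ... | inj₁ δ≡0   = inj₁ (cong₂ _+_ δ≡0 δ≡0)
  ... | inj₂ δ≡2^m = inj₂ (trans (cong₂ _+_ δ≡2^m δ≡2^m)
                                 (cong (λ p → + (2 ℕ.^ m ℕ.+ p)) (sym (ℕ.+-identityʳ (2 ℕ.^ m)))))

  weight-surjective : ∀ {m s} → s ≤ m → ∃ λ (S : Vec Bool m) → weight S ≡ s
  weight-surjective {zero}          z≤n       = [] , refl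
  weight-surjective {suc m} {zero}  z≤n       with weight-surjective {m} z≤n
  ... | S , wS≡0 = false ∷ S , wS≡0
  weight-surjective {suc m} {suc s} (s≤s s≤m) with weight-surjective s≤m
  ... | S , wS≡s = true ∷ S , cong suc wS≡s

  even-or-odd : ∀ s → (∃ λ r → s ≡ r ℕ.+ r) ⊎ (∃ λ r → s ≡ suc (r ℕ.+ r))
  even-or-odd zero    = inj₁ (0 , refl)
  even-or-odd (suc s) with even-or-odd s
  ... | inj₁ (r , s≡r+r)   = inj₂ (r , cong suc s≡r+r)
  ... | inj₂ (r , s≡1+r+r) = inj₁ (suc r , trans (cong suc s≡1+r+r) (cong suc (sym (ℕ.+-suc r r))))

  pos[8k+2] : ∀ k → + (8 ℕ.* k ℕ.+ 2) ≡ + 8 * + k + + 2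
  pos[8k+2] k = trans (ℤ.pos-+ (8 ℕ.* k) 2) (cong (_+ + 2) (ℤ.pos-* 8 k))

  8∣krawtchoukSum : ∀ k s → + 8 Signed.∣ krawtchoukSum (+ (8 ℕ.* k ℕ.+ 2)) (+ s)
  8∣krawtchoukSum k s rewrite pos[8k+2] k with even-or-odd s
  ... | inj₁ (r , refl) = Signed.divides (+ 8 * K * K + + 5 * K + + 2 * R * R - + 8 * K * R - + 3 * R + + 1) (even K R)
    where
    K = + k
    R = + r
    even : ∀ K R → let M = + 8 * K + + 2; d = M - + 2 * (R + R) + + 1 in
      d * d + + 1 - M ≡ (+ 8 * K * K + + 5 * K + + 2 * R * R - + 8 * K * R - + 3 * R + + 1) * + 8
    even = solve-∀
  ... | inj₂ (r , refl) = Signed.divides (+ 8 * K * K + K + + 2 * R * R - + 8 * K * R - R) (odd K R)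
    where
    K = + k
    R = + r
    odd : ∀ K R → let M = + 8 * K + + 2; d = M - + 2 * (+ 1 + (R + R)) + + 1 in
      d * d + + 1 - M ≡ (+ 8 * K * K + K + + 2 * R * R - + 8 * K * R - R) * + 8
    odd = solve-∀

  krawtchoukSum-8*odd : ∀ k → 1 ≤ k → ∃ λ s → ∃ λ W →
    1 ≤ s × s ≤ 8 ℕ.* k ℕ.+ 2 × krawtchoukSum (+ (8 ℕ.* k ℕ.+ 2)) (+ s) ≡ + 8 * (+ 1 + + 2 * W)
  -- s = 4k or 4k + 1 makes m − 2s + 1 equal to 3 or 1.
  krawtchoukSum-8*odd k 1≤k with even-or-odd k
  ... | inj₁ (r , refl) = 4 ℕ.* k , - + r , ℕ.≤-trans 1≤k (ℕ.m≤n*m k 4) , 4k≤8k+2 , (begin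
    krawtchoukSum (+ (8 ℕ.* k ℕ.+ 2)) (+ (4 ℕ.* k))      ≡⟨ cong₂ krawtchoukSum (pos[8k+2] k) (ℤ.pos-* 4 k) ⟩
    krawtchoukSum (+ 8 * (R + R) + + 2) (+ 4 * (R + R))  ≡⟨ at-4k R ⟩
    + 8 * (+ 1 + + 2 * - R)                              ∎)
    where
    R = + r
    4k≤8k+2 : 4 ℕ.* k ≤ 8 ℕ.* k ℕ.+ 2
    4k≤8k+2 = ℕ.≤-trans (ℕ.*-monoˡ-≤ k (ℕ.m≤m+n 4 4)) (ℕ.m≤m+n (8 ℕ.* k) 2)
    at-4k : ∀ R → let K = R + R; M = + 8 * K + + 2; d = M - + 2 * (+ 4 * K) + + 1 in
      d * d + + 1 - M ≡ + 8 * (+ 1 + + 2 * - R)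
    at-4k = solve-∀
  ... | inj₂ (r , refl) = 4 ℕ.* k ℕ.+ 1 , - + r - + 1 , ℕ.m≤n+m 1 (4 ℕ.* k) , 4k+1≤8k+2 , (begin
    krawtchoukSum (+ (8 ℕ.* k ℕ.+ 2)) (+ (4 ℕ.* k ℕ.+ 1))
      ≡⟨ cong₂ krawtchoukSum (pos[8k+2] k) (trans (ℤ.pos-+ (4 ℕ.* k) 1) (cong (_+ + 1) (ℤ.pos-* 4 k))) ⟩
    krawtchoukSum (+ 8 * (+ 1 + (R + R)) + + 2) (+ 4 * (+ 1 + (R + R)) + + 1)
      ≡⟨ at-4k+1 R ⟩
    + 8 * (+ 1 + + 2 * (- R - + 1))
      ∎)
    where
    R = + r
    4k+1≤8k+2 : 4 ℕ.* k ℕ.+ 1 ≤ 8 ℕ.* k ℕ.+ 2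
    4k+1≤8k+2 = ℕ.+-mono-≤ (ℕ.*-monoˡ-≤ k (ℕ.m≤m+n 4 4)) (ℕ.m≤m+n 1 1)
    at-4k+1 : ∀ R → let K = + 1 + (R + R); M = + 8 * K + + 2; d = M - + 2 * (+ 4 * K + + 1) + + 1 in
      d * d + + 1 - M ≡ + 8 * (+ 1 + + 2 * (- R - + 1))
    at-4k+1 = solve-∀

  8∣δ∅ : ∀ {m} → 3 ≤ m → (S : Vec Bool m) → + 8 Signed.∣ δ∅ S
  8∣δ∅ 3≤m S with δ∅≡0⊎2^m S
  ... | inj₁ δ≡0   = subst (+ 8 Signed.∣_) (sym δ≡0) (Signed.divides (+ 0) refl)
  ... | inj₂ δ≡2^m = subst (+ 8 Signed.∣_) (sym δ≡2^m) (Signed.∣ᵤ⇒∣ (2^-mono-∣ 3≤m))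

  3≤8k+2 : ∀ {k} → 1 ≤ k → 3 ≤ 8 ℕ.* k ℕ.+ 2
  3≤8k+2 1≤k = ℕ.m≤n⇒m≤n+o 2 (ℕ.≤-trans (s≤s (s≤s (s≤s z≤n))) (ℕ.*-monoʳ-≤ 8 1≤k))

  numerator-THR3-divisible : ∀ k → 1 ≤ k → (S : Vec Bool (8 ℕ.* k ℕ.+ 2)) →
    2 ^ 3 ∣ ℤ.∣ numerator _ (THR3 (8 ℕ.* k ℕ.+ 2)) S ∣
  numerator-THR3-divisible k 1≤k S = subst (λ z → 8 ∣ ℤ.∣ z ∣) (sym (numerator-THR3 _ S))
    (Signed.∣⇒∣ᵤ (Signed.∣m∣n⇒∣m-n (8∣krawtchoukSum k (weight S)) (8∣δ∅ (3≤8k+2 1≤k) S)))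

  numerator-THR3-not-16∣ : ∀ k → 1 ≤ k →
    ∃ λ (S : Vec Bool (8 ℕ.* k ℕ.+ 2)) → ¬ 2 ^ 4 ∣ ℤ.∣ numerator _ (THR3 (8 ℕ.* k ℕ.+ 2)) S ∣
  numerator-THR3-not-16∣ k 1≤k with krawtchoukSum-8*odd k 1≤k
  ... | s , W , 1≤s , s≤n , value with weight-surjective s≤n
  ...   | S , wS≡s = S , subst (λ z → ¬ 16 ∣ ℤ.∣ z ∣) (sym numerator≡8*odd) (¬2^[1+a]∣2^a*odd 3 W)
    where
    n = 8 ℕ.* k ℕ.+ 2
    numerator≡8*odd : numerator n (THR3 n) S ≡ + 8 * (+ 1 + + 2 * W)
    numerator≡8*odd = begin
      numerator n (THR3 n) S                   ≡⟨ numerator-THR3 n S ⟩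
      krawtchoukSum (+ n) (+ weight S) - δ∅ S
        ≡⟨ cong₂ (λ w δ → krawtchoukSum (+ n) (+ w) - δ) wS≡s (δ∅-nonempty S (λ w≡0 → ℕ.<⇒≢ 1≤s (trans (sym w≡0) wS≡s))) ⟩
      krawtchoukSum (+ n) (+ s) - + 0          ≡⟨ ℤ.+-identityʳ _ ⟩
      krawtchoukSum (+ n) (+ s)                ≡⟨ value ⟩
      + 8 * (+ 1 + + 2 * W)                    ∎

open Numerators

open import Data.Nat using (ℕ; _+_; _*_; _∸_; _≥_)

lemma16 : ∀ (k : ℕ) → k ≥ 1 → IsGranFun (8 * k + 2) (THR3 (8 * k + 2)) ((8 * k + 2) ∸ 3)
lemma16 k k≥1 = isGranFun-dyadic (THR3 (8 * k + 2)) (3≤8k+2 k≥1)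
  (numerator-THR3-divisible k k≥1) (numerator-THR3-not-16∣ k k≥1)
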